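{- If a simple graph $G=(V,E)$ without isolated vertices is connected and minimal transversal-free, then $G$ is the line graph of a simple graph.
   Context: Regard $G$ as the hypergraph $E\subseteq 2^V$. $G$ is transversal-free if for every edge there is an edge disjoint from it. For $S\subseteq V$, $E_S$ denotes the set of edges with both ends in $S$. $G$ is minimal transversal-free if it is transversal-free and for every $S\subsetneq V$ with $E_S\neq\emptyset$ there is an edge in $E_S$ meeting all edges of $E_S$. -}

module Defs where

open import Data.Nat using (ℕ)
open import Data.Fin using (Fin; _<_)
open import Data.Bool using (Bool; true; false)
open import Data.Product using (Σ; ∃; ∃-syntax; _×_; _,_; proj₁; proj₂)
open import Data.Sum using (_⊎_)
open import Relation.Binary.PropositionalEquality using (_≡_; _≢_)
open import Relation.Nullary using (¬_)

record Graph (n : ℕ) : Set where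
  field
    Adj    : Fin n → Fin n → Bool
    sym    : ∀ u v → Adj u v ≡ Adj v u
    irrefl : ∀ v → Adj v v ≡ false

open Graph public

IsEdge : ∀ {n} → Graph n → Fin n → Fin n → Set
IsEdge G u v = Adj G u v ≡ true

Disjoint : ∀ {n} → Fin n → Fin n → Fin n → Fin n → Set
Disjoint u v x y = u ≢ x × u ≢ y × v ≢ x × v ≢ y

Meet : ∀ {n} → Fin n → Fin n → Fin n → Fin n → Set
Meet u v x y = u ≡ x ⊎ u ≡ y ⊎ v ≡ x ⊎ v ≡ y

NoIsolated : ∀ {n} → Graph n → Set
NoIsolated G = ∀ v → ∃[ u ] IsEdge G v u

data Reachable {n} (G : Graph n) : Fin n → Fin n → Set where
  here : ∀ {v} → Reachable G v v
  step : ∀ {u w v} → IsEdge G u w → Reachable G w v → Reachable G u v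

Connected : ∀ {n} → Graph n → Set
Connected G = ∀ u v → Reachable G u v

TransversalFree : ∀ {n} → Graph n → Set
TransversalFree G =
  ∀ u v → IsEdge G u v → ∃[ x ] ∃[ y ] (IsEdge G x y × Disjoint u v x y)

InEdgeSet : ∀ {n} → Graph n → (Fin n → Bool) → Fin n → Fin n → Set
InEdgeSet G S u v = IsEdge G u v × S u ≡ true × S v ≡ true

ProperSubset : ∀ {n} → (Fin n → Bool) → Set
ProperSubset S = ∃[ v ] S v ≡ false

MinimalTransversalFree : ∀ {n} → Graph n → Set
MinimalTransversalFree {n} G =
  TransversalFree G ×
  (∀ (S : Fin n → Bool) → ProperSubset S →
     (∃[ u ] ∃[ v ] InEdgeSet G S u v) →
     ∃[ u ] ∃[ v ] (InEdgeSet G S u v ×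
       (∀ x y → InEdgeSet G S x y → Meet u v x y)))

-- G is the line graph of H: a bijection f from V(G) onto the edges of H
-- (each edge {a,b} of H written uniquely as (a,b) with a < b) such that
-- u,v are adjacent in G iff u ≠ v and f u, f v share an endpoint.
IsLineGraphOf : ∀ {n m} → Graph n → Graph m → Set
IsLineGraphOf {n} {m} G H =
  Σ (Fin n → Fin m × Fin m) λ f →
    (∀ v → proj₁ (f v) < proj₂ (f v) × IsEdge H (proj₁ (f v)) (proj₂ (f v))) ×
    (∀ u v → f u ≡ f v → u ≡ v) ×
    (∀ a b → a < b → IsEdge H a b → ∃[ v ] f v ≡ (a , b)) ×
    (∀ u v → IsEdge G u v →
        (u ≢ v × Meet (proj₁ (f u)) (proj₂ (f u)) (proj₁ (f v)) (proj₂ (f v)))) ×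
    (∀ u v → u ≢ v → Meet (proj₁ (f u)) (proj₂ (f u)) (proj₁ (f v)) (proj₂ (f v)) →
        IsEdge G u v)

IsLineGraph : ∀ {n} → Graph n → Set
IsLineGraph G = ∃[ m ] Σ (Graph m) λ H → IsLineGraphOf G H

-- Such a graph has at most six vertices.  Fix a vertex w: minimality applied to V ∖ {w} gives
-- an edge uv meeting every edge of G − w, so every vertex outside S = {u, v, w} has all its
-- neighbours in S.  For such an outsider x, minimality applied to V ∖ {x} gives an edge pq
-- meeting every edge of G − x, and since pq is not a transversal, x has a neighbour t ∈ S
-- outside {p, q}.  If two outsiders x, y had the same t, then y would lie in {p, q}, making
-- every other outsider a leaf hanging from one common vertex; but two such leaves contradict
-- transversal-freeness and minimality.  So outsiders have distinct neighbours t in S and there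
-- are at most three of them.  Graphs on at most six vertices are settled by exhaustive
-- computation: each one satisfying the hypotheses gets a root graph found by search and verified.

module Submission where

open import Data.Bool using (Bool; true; false; T; not; _∧_; _∨_; _xor_; if_then_else_)
open import Data.Bool.ListAction using (all)
open import Data.Bool.Properties using (T-≡; T-∧; T-∨; ∨-comm)
open import Data.Empty using (⊥; ⊥-elim)
open import Data.Fin as Fin using (Fin; zero; suc; _<_; punchIn; punchOut; _↑ˡ_)
open import Data.Fin.Properties as Fin
  using ( _≟_; _<?_; <-cmp; <-irrefl; <-asym; <⇒≢; pigeonhole; ↑ˡ-injective
        ; punchIn-injective; punchInᵢ≢i; punchIn-punchOut; punchOut-injective)
open import Data.List using (List; []; _∷_; length; lookup; filter; filterᵇ; cartesianProduct; allFin; concatMap; map; upTo; _++_)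
import Data.List.Properties as List
open import Data.List.Membership.Propositional using (_∈_; _∉_; lose)
open import Data.List.Membership.DecPropositional using (_∈?_)
open import Data.List.Membership.Propositional.Properties using (∈-filter⁺; ∈-filter⁻; ∈-cartesianProduct⁺; ∈-allFin)
open import Data.List.Relation.Unary.All as All using (All; all?)
open import Data.List.Relation.Unary.Any as Any using (Any; any?; here; there; index)
open import Data.List.Relation.Unary.Any.Properties using (lookup-index)
open import Data.Nat as ℕ using (ℕ; suc; _≤_; _≤?_; _≡ᵇ_; _⊔_; s≤s)
open import Data.Nat.DivMod using (_mod_)
import Data.Nat.Properties as ℕ
open import Data.Product using (∃; ∃₂; _×_; _,_; proj₁; proj₂; uncurry)
open import Data.Product.Properties using (≡-dec)
open import Data.Sum using (_⊎_; inj₁; inj₂)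
open import Function using (_∘_)
open import Function.Bundles using (Equivalence)
open import Relation.Binary.Definitions using (DecidableEquality; tri<; tri≈; tri>)
open import Relation.Binary.PropositionalEquality as ≡ using (_≡_; _≢_; refl; ≢-sym; cong; subst)
open import Relation.Nullary using (Dec; does; yes; no; ¬_; ¬?; _×-dec_; _⊎-dec_; _→-dec_)
open import Relation.Nullary.Decidable using (T?; isYes; isYes≗does; dec-true; dec-false; toWitness; fromWitness)
open import Defs

private variable
  n m : ℕ

module _ {i j : Fin (suc m)} (i≢j : i ≢ j) where

  punchIn-≢ : ∀ {k} → k ≢ punchOut i≢j → punchIn i k ≢ j
  punchIn-≢ k≢ eq = k≢ (punchIn-injective i _ _ (≡.trans eq (≡.sym (punchIn-punchOut i≢j))))

module _ {i j : Fin (suc (suc m))} (i≢j : i ≢ j) where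

  avoid₂ : Fin m → Fin (suc (suc m))
  avoid₂ = punchIn i ∘ punchIn (punchOut i≢j)

  avoid₂-injective : ∀ k l → avoid₂ k ≡ avoid₂ l → k ≡ l
  avoid₂-injective k l = punchIn-injective _ k l ∘ punchIn-injective i _ _

  avoid₂-≢ˡ : ∀ k → avoid₂ k ≢ i
  avoid₂-≢ˡ k = punchInᵢ≢i i _

  avoid₂-≢ʳ : ∀ k → avoid₂ k ≢ j
  avoid₂-≢ʳ k = punchIn-≢ i≢j (punchInᵢ≢i _ k)

module _ {u v w : Fin (suc (suc (suc m)))} (u≢v : u ≢ v) (u≢w : u ≢ w) (v≢w : v ≢ w) where

  private
    v′≢w′ : punchOut u≢v ≢ punchOut u≢w
    v′≢w′ = v≢w ∘ punchOut-injective u≢v u≢w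

  avoid₃ : Fin m → Fin (suc (suc (suc m)))
  avoid₃ = punchIn u ∘ avoid₂ v′≢w′

  avoid₃-injective : ∀ k l → avoid₃ k ≡ avoid₃ l → k ≡ l
  avoid₃-injective k l = avoid₂-injective v′≢w′ k l ∘ punchIn-injective u _ _

  avoid₃-∉ : ∀ k → avoid₃ k ∉ u ∷ v ∷ w ∷ []
  avoid₃-∉ k (here eq)                 = punchInᵢ≢i u _ eq
  avoid₃-∉ k (there (here eq))         = punchIn-≢ u≢v (avoid₂-≢ˡ v′≢w′ k) eq
  avoid₃-∉ k (there (there (here eq))) = punchIn-≢ u≢w (avoid₂-≢ʳ v′≢w′ k) eq

pigeonhole-∈ : ∀ {A : Set} (xs : List A) → length xs ℕ.< m → (f : Fin m → A) → (∀ i → f i ∈ xs) →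
               ∃₂ λ i j → i ≢ j × f i ≡ f j
pigeonhole-∈ xs lt f f∈ with i , j , i<j , eq ← pigeonhole lt (index ∘ f∈) =
  i , j , <⇒≢ i<j ,
  ≡.trans (lookup-index (f∈ i)) (≡.trans (cong (lookup xs) eq) (≡.sym (lookup-index (f∈ j))))

module _ (G : Graph n) where

  edge-sym : ∀ {u v} → IsEdge G u v → IsEdge G v u
  edge-sym {u} {v} = ≡.trans (sym G v u)

  edge-≢ : ∀ {u v} → IsEdge G u v → u ≢ v
  edge-≢ {u} e refl with ≡.trans (≡.sym e) (irrefl G u)
  ... | ()

  CoversAwayFrom : Fin n → Fin n → Fin n → Set
  CoversAwayFrom w u v = ∀ x y → IsEdge G x y → x ≢ w → y ≢ w → Meet u v x y

  DeletionCovered : Set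
  DeletionCovered = ∀ w x y → IsEdge G x y → x ≢ w → y ≢ w →
    ∃₂ λ u v → IsEdge G u v × u ≢ w × v ≢ w × CoversAwayFrom w u v

Meet-swapˡ : ∀ {a b c d : Fin n} → Meet a b c d → Meet b a c d
Meet-swapˡ (inj₁ e)                 = inj₂ (inj₂ (inj₁ e))
Meet-swapˡ (inj₂ (inj₁ e))          = inj₂ (inj₂ (inj₂ e))
Meet-swapˡ (inj₂ (inj₂ (inj₁ e)))   = inj₁ e
Meet-swapˡ (inj₂ (inj₂ (inj₂ e)))   = inj₂ (inj₁ e)

Disjoint⇒¬Meet : ∀ {a b c d : Fin n} → Disjoint a b c d → Meet a b c d → ⊥
Disjoint⇒¬Meet (a≢c , _ , _ , _) (inj₁ e)               = a≢c e
Disjoint⇒¬Meet (_ , a≢d , _ , _) (inj₂ (inj₁ e))        = a≢d e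
Disjoint⇒¬Meet (_ , _ , b≢c , _) (inj₂ (inj₂ (inj₁ e))) = b≢c e
Disjoint⇒¬Meet (_ , _ , _ , b≢d) (inj₂ (inj₂ (inj₂ e))) = b≢d e

module _ (w : Fin n) where

  allBut : Fin n → Bool
  allBut x = not (does (x ≟ w))

  allBut-self : allBut w ≡ false
  allBut-self = cong not (dec-true (w ≟ w) refl)

  allBut-≢ : ∀ {x} → x ≢ w → allBut x ≡ true
  allBut-≢ {x} x≢w = cong not (dec-false (x ≟ w) x≢w)

  allBut⇒≢ : ∀ {x} → allBut x ≡ true → x ≢ w
  allBut⇒≢ x∈ refl with ≡.trans (≡.sym x∈) allBut-self
  ... | ()

minimal⇒deletionCovered : (G : Graph n) → MinimalTransversalFree G → DeletionCovered G
minimal⇒deletionCovered G (_ , minimal) w x y exy x≢w y≢w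
  with u , v , (euv , u∈ , v∈) , covers ←
       minimal (allBut w) (w , allBut-self w) (x , y , exy , allBut-≢ w x≢w , allBut-≢ w y≢w)
  = u , v , euv , allBut⇒≢ w u∈ , allBut⇒≢ w v∈ ,
    λ a b eab a≢w b≢w → covers a b (eab , allBut-≢ w a≢w , allBut-≢ w b≢w)

module Structure {G : Graph n} (tf : TransversalFree G) (dc : DeletionCovered G) where

  privateNeighbour : ∀ {x p q} → IsEdge G p q → CoversAwayFrom G x p q →
                     ∃ λ t → IsEdge G x t × t ≢ p × t ≢ q
  privateNeighbour {x} epq covers with tf _ _ epq
  ... | r , s , ers , pq#rs@(p≢r , p≢s , q≢r , q≢s) with r ≟ x | s ≟ x
  ... | yes refl | _        = s , ers , ≢-sym p≢s , ≢-sym q≢s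
  ... | no _     | yes refl = r , edge-sym G ers , ≢-sym p≢r , ≢-sym q≢r
  ... | no r≢x   | no s≢x   = ⊥-elim (Disjoint⇒¬Meet pq#rs (covers r s ers r≢x s≢x))

  record LocalCover (x : Fin n) : Set where
    field
      p q t  : Fin n
      edge   : IsEdge G p q
      covers : CoversAwayFrom G x p q
      t-edge : IsEdge G x t
      t≢p    : t ≢ p
      t≢q    : t ≢ q

    neighbourOf-t : ∀ {y} → y ≢ x → IsEdge G y t → y ≡ p ⊎ y ≡ q
    neighbourOf-t y≢x eyt with covers _ _ eyt y≢x (edge-≢ G (edge-sym G t-edge))
    ... | inj₁ p≡y               = inj₁ (≡.sym p≡y)
    ... | inj₂ (inj₁ p≡t)        = ⊥-elim (t≢p (≡.sym p≡t))
    ... | inj₂ (inj₂ (inj₁ q≡y)) = inj₂ (≡.sym q≡y)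
    ... | inj₂ (inj₂ (inj₂ q≡t)) = ⊥-elim (t≢q (≡.sym q≡t))

  localCover : ∀ {x a b} → IsEdge G a b → a ≢ x → b ≢ x → LocalCover x
  localCover {x} eab a≢x b≢x
    with p , q , epq , _ , _ , covers ← dc x _ _ eab a≢x b≢x
    with t , ext , t≢p , t≢q ← privateNeighbour epq covers
    = record { p = p ; q = q ; t = t ; edge = epq ; covers = covers ; t-edge = ext ; t≢p = t≢p ; t≢q = t≢q }

  noTwinLeaves : ∀ {y z a b} → y ≢ z → IsEdge G z b →
                 (∀ c → IsEdge G y c → c ≡ a) → (∀ c → IsEdge G z c → c ≡ a) → ⊥
  noTwinLeaves {y} {z} {a} y≢z ezb leafʸ leafᶻ = absurd (covers z a eza z≢y a≢y)
    where
    eza = subst (IsEdge G z) (leafᶻ _ ezb) ezb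
    z≢y = ≢-sym y≢z
    a≢y : a ≢ y
    a≢y refl = y≢z (≡.sym (leafʸ z (edge-sym G eza)))
    open LocalCover (localCover eza z≢y a≢y)
    t≡a : t ≡ a
    t≡a = leafʸ t t-edge
    absurd : Meet p q z a → ⊥
    absurd (inj₁ p≡z)               = t≢q (≡.trans t≡a (≡.sym (leafᶻ q (subst (λ c → IsEdge G c q) p≡z edge))))
    absurd (inj₂ (inj₁ p≡a))        = t≢p (≡.trans t≡a (≡.sym p≡a))
    absurd (inj₂ (inj₂ (inj₁ q≡z))) = t≢p (≡.trans t≡a (≡.sym (leafᶻ p (subst (λ c → IsEdge G c p) q≡z (edge-sym G edge)))))
    absurd (inj₂ (inj₂ (inj₂ q≡a))) = t≢q (≡.trans t≡a (≡.sym q≡a))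

  module Outsiders {w u v} (euv : IsEdge G u v) (cov : CoversAwayFrom G w u v) where

    S : List (Fin n)
    S = u ∷ v ∷ w ∷ []

    ∈-∉⇒≢ : ∀ {x y} → y ∈ S → x ∉ S → x ≢ y
    ∈-∉⇒≢ y∈ x∉ refl = x∉ y∈

    neighbour∈S : ∀ {x y} → x ∉ S → IsEdge G x y → y ∈ S
    neighbour∈S {x} {y} x∉ exy with y ≟ w
    ... | yes y≡w = there (there (here y≡w))
    ... | no y≢w with cov x y exy (x∉ ∘ there ∘ there ∘ here) y≢w
    ... | inj₁ u≡x               = ⊥-elim (x∉ (here (≡.sym u≡x)))
    ... | inj₂ (inj₁ u≡y)        = here (≡.sym u≡y)
    ... | inj₂ (inj₂ (inj₁ v≡x)) = ⊥-elim (x∉ (there (here (≡.sym v≡x))))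
    ... | inj₂ (inj₂ (inj₂ v≡y)) = there (here (≡.sym v≡y))

    localCoverOf : ∀ {x} → x ∉ S → LocalCover x
    localCoverOf x∉ = localCover euv (x∉ ∘ here ∘ ≡.sym) (x∉ ∘ there ∘ here ∘ ≡.sym)

    leafAt : ∀ {x y a z} → x ∉ S → y ∉ S → IsEdge G y a → CoversAwayFrom G x y a →
             z ∉ S → z ≢ x → z ≢ y → ∀ b → IsEdge G z b → b ≡ a
    leafAt {y = y} {a} {z} x∉ y∉ eya covers z∉ z≢x z≢y b ezb =
      onCover (covers z b ezb z≢x (≢-sym (∈-∉⇒≢ b∈ x∉)))
      where
      b∈ = neighbour∈S z∉ ezb
      onCover : Meet y a z b → b ≡ a
      onCover (inj₁ y≡z)               = ⊥-elim (z≢y (≡.sym y≡z))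
      onCover (inj₂ (inj₁ y≡b))        = ⊥-elim (∈-∉⇒≢ b∈ y∉ y≡b)
      onCover (inj₂ (inj₂ (inj₁ a≡z))) = ⊥-elim (∈-∉⇒≢ (neighbour∈S y∉ eya) z∉ (≡.sym a≡z))
      onCover (inj₂ (inj₂ (inj₂ a≡b))) = ≡.sym a≡b

    atMostOneMoreOutsider : ∀ {x y a z z′} → x ∉ S → y ∉ S → IsEdge G y a → CoversAwayFrom G x y a →
      z ∉ S → z′ ∉ S → z ≢ x → z ≢ y → z′ ≢ x → z′ ≢ y → z ≢ z′ → ⊥
    atMostOneMoreOutsider x∉ y∉ eya covers z∉ z′∉ z≢x z≢y z′≢x z′≢y z≢z′ =
      noTwinLeaves z≢z′ (LocalCover.t-edge (localCoverOf z′∉))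
        (leafAt x∉ y∉ eya covers z∉ z≢x z≢y) (leafAt x∉ y∉ eya covers z′∉ z′≢x z′≢y)

    noSharedPrivateNeighbour : ∀ {x y z z′} (L : LocalCover x) → x ∉ S → y ∉ S → z ∉ S → z′ ∉ S →
      y ≢ x → IsEdge G y (LocalCover.t L) → z ≢ x → z ≢ y → z′ ≢ x → z′ ≢ y → z ≢ z′ → ⊥
    noSharedPrivateNeighbour L x∉ y∉ z∉ z′∉ y≢x eyt with LocalCover.neighbourOf-t L y≢x eyt
    ... | inj₁ refl = atMostOneMoreOutsider x∉ y∉ edge covers z∉ z′∉
      where open LocalCover L
    ... | inj₂ refl = atMostOneMoreOutsider x∉ y∉ (edge-sym G edge) (λ c d ecd c≢ d≢ → Meet-swapˡ (covers c d ecd c≢ d≢)) z∉ z′∉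
      where open LocalCover L

    atMostThreeOutsiders : (h : Fin 4 → Fin n) → (∀ i j → h i ≡ h j → i ≡ j) → (∀ i → h i ∉ S) → ⊥
    atMostThreeOutsiders h h-inj h∉ = sharing (pigeonhole-∈ S ℕ.≤-refl (t ∘ L) (λ i → neighbour∈S (h∉ i) (t-edge (L i))))
      where
      open LocalCover
      L : ∀ i → LocalCover (h i)
      L i = localCoverOf (h∉ i)
      h-≢ : ∀ {i j} → i ≢ j → h i ≢ h j
      h-≢ i≢j = i≢j ∘ h-inj _ _
      0≢1 : Fin.zero {1} ≢ suc zero
      0≢1 ()
      sharing : (∃₂ λ i j → i ≢ j × t (L i) ≡ t (L j)) → ⊥
      sharing (i , j , i≢j , tᵢ≡tⱼ) =
        noSharedPrivateNeighbour (L i) (h∉ i) (h∉ j) (h∉ _) (h∉ _) (h-≢ (≢-sym i≢j))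
          (subst (IsEdge G (h j)) (≡.sym tᵢ≡tⱼ) (t-edge (L j)))
          (h-≢ (avoid₂-≢ˡ i≢j zero)) (h-≢ (avoid₂-≢ʳ i≢j zero))
          (h-≢ (avoid₂-≢ˡ i≢j (suc zero))) (h-≢ (avoid₂-≢ʳ i≢j (suc zero)))
          (h-≢ (0≢1 ∘ avoid₂-injective i≢j _ _))

noSevenVertices : (G : Graph n) → 7 ≤ n → NoIsolated G → TransversalFree G → DeletionCovered G → ⊥
noSevenVertices G (s≤s (s≤s (s≤s (s≤s (s≤s (s≤s (s≤s {n = k} _))))))) noIso tf dc
  with b , e0b ← noIso zero
  with c , d , ecd , (0≢c , 0≢d , _ , _) ← tf zero b e0b
  with u , v , euv , u≢0 , v≢0 , covers ← dc zero c d ecd (≢-sym 0≢c) (≢-sym 0≢d)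
  = Outsiders.atMostThreeOutsiders euv covers (avoid₃ u≢v u≢0 v≢0 ∘ (_↑ˡ k))
      (λ i j → ↑ˡ-injective k i j ∘ avoid₃-injective u≢v u≢0 v≢0 _ _) (avoid₃-∉ u≢v u≢0 v≢0 ∘ (_↑ˡ k))
  where
  open Structure {G = G} tf dc
  u≢v = edge-≢ G euv

atMostSixVertices : (G : Graph n) → NoIsolated G → TransversalFree G → DeletionCovered G → n ≤ 6
atMostSixVertices {n} G noIso tf dc with n ≤? 6
... | yes n≤6 = n≤6
... | no n≰6  = ⊥-elim (noSevenVertices G (ℕ.≰⇒> n≰6) noIso tf dc)

Edge : ℕ → Set
Edge n = Fin n × Fin n

_≟ᵉ_ : DecidableEquality (Edge n)
_≟ᵉ_ = ≡-dec _≟_ _≟_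

Meetsᵉ : Edge n → Edge n → Set
Meetsᵉ e f = Meet (proj₁ e) (proj₂ e) (proj₁ f) (proj₂ f)

meets? : (e f : Edge n) → Dec (Meetsᵉ e f)
meets? (a , b) (c , d) = a ≟ c ⊎-dec a ≟ d ⊎-dec b ≟ c ⊎-dec b ≟ d

Disjointᵉ : Edge n → Edge n → Set
Disjointᵉ e f = Disjoint (proj₁ e) (proj₂ e) (proj₁ f) (proj₂ f)

disjoint? : (e f : Edge n) → Dec (Disjointᵉ e f)
disjoint? (a , b) (c , d) = ¬? (a ≟ c) ×-dec ¬? (a ≟ d) ×-dec ¬? (b ≟ c) ×-dec ¬? (b ≟ d)

Incident : Fin n → Edge n → Set
Incident v e = proj₁ e ≡ v ⊎ proj₂ e ≡ v

incident? : (v : Fin n) (e : Edge n) → Dec (Incident v e)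
incident? v (a , b) = a ≟ v ⊎-dec b ≟ v

Avoids : Fin n → Edge n → Set
Avoids w e = proj₁ e ≢ w × proj₂ e ≢ w

avoids? : (w : Fin n) (e : Edge n) → Dec (Avoids w e)
avoids? w (a , b) = ¬? (a ≟ w) ×-dec ¬? (b ≟ w)

pairs : ∀ n → List (Edge n)
pairs n = filter (λ e → proj₁ e <? proj₂ e) (cartesianProduct (allFin n) (allFin n))

edges : Graph n → List (Edge n)
edges {n} G = filterᵇ (uncurry (Adj G)) (pairs n)

Adjacentᴸ : List (Edge n) → Fin n → Fin n → Set
Adjacentᴸ es u v = (u , v) ∈ es ⊎ (v , u) ∈ es

adjacentᴸ? : (es : List (Edge n)) (u v : Fin n) → Dec (Adjacentᴸ es u v)
adjacentᴸ? es u v = _∈?_ _≟ᵉ_ (u , v) es ⊎-dec _∈?_ _≟ᵉ_ (v , u) es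

NoIsolatedᴸ : List (Edge n) → Set
NoIsolatedᴸ es = ∀ v → Any (Incident v) es

TransversalFreeᴸ : List (Edge n) → Set
TransversalFreeᴸ es = All (λ e → Any (Disjointᵉ e) es) es

Covered : List (Edge n) → Set
Covered es = es ≢ [] → Any (λ e → All (Meetsᵉ e) es) es

covered? : (es : List (Edge n)) → Dec (Covered es)
covered? es = ¬? (List.≡-dec _≟ᵉ_ es []) →-dec any? (λ e → all? (meets? e) es) es

DeletionCoveredᴸ : List (Edge n) → Set
DeletionCoveredᴸ es = ∀ w → Covered (filter (avoids? w) es)

Candidate : List (Edge n) → Set
Candidate es = DeletionCoveredᴸ es × NoIsolatedᴸ es × TransversalFreeᴸ es

candidate? : (es : List (Edge n)) → Dec (Candidate es)
candidate? es =
  Fin.all? (λ w → covered? (filter (avoids? w) es)) ×-dec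
  Fin.all? (λ v → any? (incident? v) es) ×-dec
  all? (λ e → any? (disjoint? e) es) es

nonEmpty : ∀ {A : Set} {xs : List A} → xs ≢ [] → ∃ λ x → x ∈ xs
nonEmpty {xs = []}    xs≢[] = ⊥-elim (xs≢[] refl)
nonEmpty {xs = x ∷ _} _     = x , here refl

module _ (G : Graph n) where

  private
    ∈-ordered : ∀ {a b} → IsEdge G a b → a < b → (a , b) ∈ edges G
    ∈-ordered {a} {b} eab a<b =
      ∈-filter⁺ (T? ∘ uncurry (Adj G)) (∈-filter⁺ _ (∈-cartesianProduct⁺ (∈-allFin a) (∈-allFin b)) a<b)
        (Equivalence.from T-≡ eab)

  ∈-edges⁻ : ∀ {e} → e ∈ edges G → IsEdge G (proj₁ e) (proj₂ e)
  ∈-edges⁻ = Equivalence.to T-≡ ∘ proj₂ ∘ ∈-filter⁻ (T? ∘ uncurry (Adj G)) {xs = pairs n}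

  edge⇒adjacent : ∀ {u v} → IsEdge G u v → Adjacentᴸ (edges G) u v
  edge⇒adjacent {u} {v} euv with <-cmp u v
  ... | tri< u<v _ _ = inj₁ (∈-ordered euv u<v)
  ... | tri≈ _ u≡v _ = ⊥-elim (edge-≢ G euv u≡v)
  ... | tri> _ _ v<u = inj₂ (∈-ordered (edge-sym G euv) v<u)

  adjacent⇒edge : ∀ {u v} → Adjacentᴸ (edges G) u v → IsEdge G u v
  adjacent⇒edge (inj₁ uv∈) = ∈-edges⁻ uv∈
  adjacent⇒edge (inj₂ vu∈) = edge-sym G (∈-edges⁻ vu∈)

  noIsolated⇒ᴸ : NoIsolated G → NoIsolatedᴸ (edges G)
  noIsolated⇒ᴸ noIso v with u , evu ← noIso v with edge⇒adjacent evu
  ... | inj₁ vu∈ = lose vu∈ (inj₁ refl)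
  ... | inj₂ uv∈ = lose uv∈ (inj₂ refl)

  transversalFree⇒ᴸ : TransversalFree G → TransversalFreeᴸ (edges G)
  transversalFree⇒ᴸ tf = All.tabulate λ e∈ → disjointEdge (tf _ _ (∈-edges⁻ e∈))
    where
    disjointEdge : ∀ {a b} → (∃₂ λ x y → IsEdge G x y × Disjoint a b x y) → Any (Disjointᵉ (a , b)) (edges G)
    disjointEdge (x , y , exy , ab#xy@(a≢x , a≢y , b≢x , b≢y)) with edge⇒adjacent exy
    ... | inj₁ xy∈ = lose xy∈ ab#xy
    ... | inj₂ yx∈ = lose yx∈ (a≢y , a≢x , b≢y , b≢x)

  covers⇒ᴸ : ∀ {w u v} → CoversAwayFrom G w u v → All (Meetsᵉ (u , v)) (filter (avoids? w) (edges G))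
  covers⇒ᴸ {w} covers = All.tabulate λ f∈ →
    let f∈E , (f₁≢w , f₂≢w) = ∈-filter⁻ (avoids? w) {xs = edges G} f∈ in covers _ _ (∈-edges⁻ f∈E) f₁≢w f₂≢w

  deletionCovered⇒ᴸ : DeletionCovered G → DeletionCoveredᴸ (edges G)
  deletionCovered⇒ᴸ dc w es′≢[]
    with x , x∈ ← nonEmpty es′≢[]
    with x∈E , (x₁≢w , x₂≢w) ← ∈-filter⁻ (avoids? w) {xs = edges G} x∈
    with u , v , euv , u≢w , v≢w , covers ← dc w _ _ (∈-edges⁻ x∈E) x₁≢w x₂≢w
    with edge⇒adjacent euv
  ... | inj₁ uv∈ = lose (∈-filter⁺ (avoids? w) uv∈ (u≢w , v≢w)) (covers⇒ᴸ covers)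
  ... | inj₂ vu∈ = lose (∈-filter⁺ (avoids? w) vu∈ (v≢w , u≢w))
                        (covers⇒ᴸ (λ a b eab a≢w b≢w → Meet-swapˡ (covers a b eab a≢w b≢w)))

-- Root graphs

IsRootᴸ : List (Edge n) → (Fin n → Edge m) → Set
IsRootᴸ es ρ = (∀ v → proj₁ (ρ v) < proj₂ (ρ v)) ×
  (∀ u v → u ≢ v → ρ u ≢ ρ v × (Adjacentᴸ es u v → Meetsᵉ (ρ u) (ρ v)) × (Meetsᵉ (ρ u) (ρ v) → Adjacentᴸ es u v))

isRoot? : (es : List (Edge n)) (ρ : Fin n → Edge m) → Dec (IsRootᴸ es ρ)
isRoot? es ρ = Fin.all? (λ v → ordered? (ρ v)) ×-dec Fin.all? (λ u → Fin.all? λ v → faithful? u v (ρ u) (ρ v))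
  where
  ordered? : (e : Edge _) → Dec (proj₁ e < proj₂ e)
  ordered? (a , b) = a <? b
  agree? : ∀ {A B : Set} → Dec A → Dec B → Dec ((A → B) × (B → A))
  agree? a? b? = (a? →-dec b?) ×-dec (b? →-dec a?)
  faithful? : ∀ u v e f → Dec (u ≢ v → e ≢ f × (Adjacentᴸ es u v → Meetsᵉ e f) × (Meetsᵉ e f → Adjacentᴸ es u v))
  faithful? u v e f = ¬? (u ≟ v) →-dec ¬? (e ≟ᵉ f) ×-dec agree? (adjacentᴸ? es u v) (meets? e f)

preimage? : (ρ : Fin n → Edge m) (e : Edge m) → Dec (∃ λ v → ρ v ≡ e)
preimage? ρ e = Fin.any? λ v → ρ v ≟ᵉ e

module _ {ρ : Fin n → Edge m} (ordered : ∀ v → proj₁ (ρ v) < proj₂ (ρ v)) where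

  hits? : Fin m → Fin m → Bool
  hits? a b = isYes (preimage? ρ (a , b))

  rootGraph : Graph m
  rootGraph = record
    { Adj    = λ a b → hits? a b ∨ hits? b a
    ; sym    = λ a b → ∨-comm (hits? a b) (hits? b a)
    ; irrefl = λ a → cong (λ x → x ∨ x) (≡.trans (isYes≗does (preimage? ρ (a , a))) (dec-false (preimage? ρ (a , a)) (noLoop a)))
    }
    where
    noLoop : ∀ a → ¬ (∃ λ v → ρ v ≡ (a , a))
    noLoop a (v , ρv≡aa) = <-irrefl (≡.trans (cong proj₁ ρv≡aa) (≡.sym (cong proj₂ ρv≡aa))) (ordered v)

isLineGraphOf-rootGraph : (G : Graph n) {ρ : Fin n → Edge m} (root : IsRootᴸ (edges G) ρ) →
                          IsLineGraphOf G (rootGraph (proj₁ root))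
isLineGraphOf-rootGraph G {ρ} (ordered , faithful) =
  ρ , (λ v → ordered v , hit v) , injective , surjective , preserves , reflects
  where
  H = rootGraph ordered
  hit : ∀ v → IsEdge H (proj₁ (ρ v)) (proj₂ (ρ v))
  hit v = cong (_∨ hits? ordered (proj₂ (ρ v)) (proj₁ (ρ v)))
               (Equivalence.to T-≡ (fromWitness {a? = preimage? ρ (ρ v)} (v , refl)))
  injective : ∀ u v → ρ u ≡ ρ v → u ≡ v
  injective u v ρu≡ρv with u ≟ v
  ... | yes u≡v = u≡v
  ... | no u≢v  = ⊥-elim (proj₁ (faithful u v u≢v) ρu≡ρv)
  surjective : ∀ a b → a < b → IsEdge H a b → ∃ λ v → ρ v ≡ (a , b)
  surjective a b a<b eab with Equivalence.to T-∨ (Equivalence.from T-≡ eab)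
  ... | inj₁ hit-ab = toWitness {a? = preimage? ρ (a , b)} hit-ab
  ... | inj₂ hit-ba with v , ρv≡ba ← toWitness {a? = preimage? ρ (b , a)} hit-ba =
    ⊥-elim (<-asym a<b (subst (λ e → proj₁ e < proj₂ e) ρv≡ba (ordered v)))
  preserves : ∀ u v → IsEdge G u v → u ≢ v × Meetsᵉ (ρ u) (ρ v)
  preserves u v euv = edge-≢ G euv , proj₁ (proj₂ (faithful u v (edge-≢ G euv))) (edge⇒adjacent G euv)
  reflects : ∀ u v → u ≢ v → Meetsᵉ (ρ u) (ρ v) → IsEdge G u v
  reflects u v u≢v = adjacent⇒edge G ∘ proj₂ (proj₂ (faithful u v u≢v))

-- Graphs on at most six vertices

everySublist : ∀ {A : Set} → (List A → Bool) → List A → Bool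
everySublist f []       = f []
everySublist f (x ∷ xs) = everySublist (f ∘ (x ∷_)) xs ∧ everySublist f xs

everySublist-filterᵇ : ∀ {A : Set} (f : List A → Bool) xs → T (everySublist f xs) →
                       (p : A → Bool) → T (f (filterᵇ p xs))
everySublist-filterᵇ f []       t p = t
everySublist-filterᵇ f (x ∷ xs) t p with Equivalence.to T-∧ t | p x
... | with-x , _    | true  = everySublist-filterᵇ (f ∘ (x ∷_)) xs with-x p
... | _ , without-x | false = everySublist-filterᵇ f xs without-x p

-- Backtracking search for roots, naming root vertices 0, 1, 2, … in order of first use.  It is
-- not trusted: every proposed root is checked by isRoot?.  Twelve root vertices suffice for six
-- vertices, so the reduction of labels mod 12 never matters where the search is used.
module RootSearch (es : List (Edge n)) where

  Label : Set
  Label = ℕ × ℕ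

  Assignment : Set
  Assignment = List (Fin n × Label)

  shareEndpoint : Label → Label → Bool
  shareEndpoint (a , b) (c , d) = (a ≡ᵇ c) ∨ (a ≡ᵇ d) ∨ (b ≡ᵇ c) ∨ (b ≡ᵇ d)

  sameLabel : Label → Label → Bool
  sameLabel (a , b) (c , d) = (a ≡ᵇ c) ∧ (b ≡ᵇ d)

  consistent : Fin n → Label → Assignment → Bool
  consistent v e = all λ (u , f) → not (sameLabel e f) ∧ not (does (adjacentᴸ? es u v) xor shareEndpoint e f)

  labelsAfter : ℕ → List Label
  labelsAfter k = concatMap (λ b → map (_, b) (upTo b)) (upTo k) ++ map (_, k) (upTo k) ++ (k , suc k) ∷ []

  extend : List (Fin n) → ℕ → Assignment → List Assignment
  extend []       k acc = acc ∷ []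
  extend (v ∷ vs) k acc = concatMap try (labelsAfter k)
    where
    try : Label → List Assignment
    try e = if consistent v e acc then extend vs (k ⊔ suc (proj₂ e)) ((v , e) ∷ acc) else []

  toRoot : Assignment → Fin n → Edge 12
  toRoot []                    v = zero , zero
  toRoot ((u , (a , b)) ∷ acc) v = if does (u ≟ v) then (a mod 12 , b mod 12) else toRoot acc v

  roots : List (Fin n → Edge 12)
  roots = map toRoot (extend (allFin n) 0 [])

everyCandidateRooted : ℕ → Bool
everyCandidateRooted n =
  everySublist (λ es → isYes (candidate? es →-dec any? (isRoot? es) (RootSearch.roots es))) (pairs n)

-- Stated with _≡ true rather than T: Agda checks it far faster in this form.
everyCandidateRooted-≤6 : n ≤ 6 → everyCandidateRooted n ≡ true
everyCandidateRooted-≤6 {0} _ = refl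
everyCandidateRooted-≤6 {1} _ = refl
everyCandidateRooted-≤6 {2} _ = refl
everyCandidateRooted-≤6 {3} _ = refl
everyCandidateRooted-≤6 {4} _ = refl
everyCandidateRooted-≤6 {5} _ = refl
everyCandidateRooted-≤6 {6} _ = refl
everyCandidateRooted-≤6 {suc (suc (suc (suc (suc (suc (suc _))))))} (s≤s (s≤s (s≤s (s≤s (s≤s (s≤s ()))))))

atMostSix⇒lineGraph : n ≤ 6 → (G : Graph n) → NoIsolated G → TransversalFree G → DeletionCovered G → IsLineGraph G
atMostSix⇒lineGraph n≤6 G noIso tf dc
  with ρ , root ← Any.satisfied
         (toWitness (everySublist-filterᵇ _ (pairs _) (Equivalence.from T-≡ (everyCandidateRooted-≤6 n≤6)) (uncurry (Adj G)))
           (deletionCovered⇒ᴸ G dc , noIsolated⇒ᴸ G noIso , transversalFree⇒ᴸ G tf))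
  = 12 , rootGraph (proj₁ root) , isLineGraphOf-rootGraph G root

lemma5p13 : ∀ {n : ℕ} (G : Graph n) → NoIsolated G → Connected G →
    MinimalTransversalFree G → IsLineGraph G
lemma5p13 G noIso _ mtf = atMostSix⇒lineGraph (atMostSixVertices G noIso tf dc) G noIso tf dc
  where
  tf = proj₁ mtf
  dc = minimal⇒deletionCovered G mtf
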